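{- For every $n\ge 1$, the complete graph $K_n$ has an ESD labeling with label set $\{1,\dots,F_{n+1}\}$.
   Context: The Fibonacci sequence is $F_0=0$, $F_1=1$, $F_m=F_{m-1}+F_{m-2}$ for $m>1$. For a graph $G=(V,E)$ and $l\in\mathbb N$, a vertex labeling $\phi:V\to\{1,\dots,l\}$ is an edge-sum distinguishing (ESD) labeling if $\phi$ is injective and the edge-weights $w_\phi(uv)=\phi(u)+\phi(v)$ are pairwise distinct over all edges $uv\in E$. -}

module Defs where

open import Data.Nat using (ℕ; zero; suc; _+_; _≤_)
open import Data.Fin using (Fin)
open import Data.Product using (_×_)
open import Data.Sum using (_⊎_)
open import Relation.Binary.PropositionalEquality using (_≡_; _≢_)
open import Function.Definitions using (Injective)

fib : ℕ → ℕ
fib zero = 0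
fib (suc zero) = 1
fib (suc (suc m)) = fib (suc m) + fib m

-- The complete graph K_n has vertex set Fin n; its edges are the
-- unordered pairs {u,v} with u ≢ v.  Two edges {u,v}, {x,y} are equal
-- iff (u ≡ x and v ≡ y) or (u ≡ y and v ≡ x).
SameEdge : {n : ℕ} → Fin n → Fin n → Fin n → Fin n → Set
SameEdge u v x y = (u ≡ x × v ≡ y) ⊎ (u ≡ y × v ≡ x)

record IsESDLabelingKn (n l : ℕ) (φ : Fin n → ℕ) : Set where
  field
    inRange   : ∀ v → 1 ≤ φ v × φ v ≤ l
    injective : Injective _≡_ _≡_ φ
    distinctWeights : ∀ u v x y → u ≢ v → x ≢ y →
      φ u + φ v ≡ φ x + φ y → SameEdge u v x y

module Submission where

-- Label vertex i of K_n (i = 0, …, n-1) by the Fibonacci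
-- number F_{i+2}; the labels are 1, 2, 3, 5, …, F_{n+1}.  The shifted
-- Fibonacci sequence g i = F_{i+2} is positive, strictly increasing and
-- "dominant": for j < i, g i + g j ≤ g i + g (i-1) = g (i+1).  Hence the
-- larger summand of a pair sum g i + g j (j < i) is pinned down:
-- g i + g j ≤ g (i+1) ≤ g k < g k + g l whenever i < k.  So equal sums of
-- two distinct-index pairs force equal larger indices, and then equal
-- smaller indices by cancellation and injectivity of g.

open import Defs
open import Data.Nat using (ℕ; zero; suc; _+_; _≤_; _<_; _≥_; z≤n; s≤s)
open import Data.Nat.Properties
open import Data.Fin using (Fin; toℕ)
open import Data.Fin.Properties using (toℕ-injective; toℕ<n)
open import Data.Product using (Σ; _×_; _,_; swap)
import Data.Product as Product
open import Data.Sum using (_⊎_; inj₁; inj₂)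
import Data.Sum as Sum
open import Data.Empty using (⊥-elim)
open import Function using (_∘_)
open import Function.Definitions using (Injective)
open import Relation.Binary.PropositionalEquality
open import Relation.Binary.Definitions using (tri<; tri≈; tri>)

monotone-from-steps : (f : ℕ → ℕ) → (∀ i → f i ≤ f (suc i)) →
  ∀ {i j} → i ≤ j → f i ≤ f j
monotone-from-steps f step {j = j} i≤j with m≤n⇒m<n∨m≡n i≤j
monotone-from-steps f step {j = suc j} _ | inj₁ (s≤s i≤j) =
  ≤-trans (monotone-from-steps f step i≤j) (step j)
... | inj₂ refl = ≤-refl

strict-from-steps : (f : ℕ → ℕ) → (∀ i → f i < f (suc i)) →
  ∀ {i j} → i < j → f i < f j
strict-from-steps f step {i} i<j =
  <-≤-trans (step i) (monotone-from-steps f (<⇒≤ ∘ step) i<j)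

injective-from-steps : (f : ℕ → ℕ) → (∀ i → f i < f (suc i)) → Injective _≡_ _≡_ f
injective-from-steps f step {i} {j} fi≡fj with <-cmp i j
... | tri< i<j _ _ = ⊥-elim (<-irrefl fi≡fj (strict-from-steps f step i<j))
... | tri≈ _ i≡j _ = i≡j
... | tri> _ _ j<i = ⊥-elim (<-irrefl (sym fi≡fj) (strict-from-steps f step j<i))

DistinctPairSums : {A : Set} → (A → ℕ) → Set
DistinctPairSums {A} φ = ∀ (u v x y : A) → u ≢ v → x ≢ y →
  φ u + φ v ≡ φ x + φ y → (u ≡ x × v ≡ y) ⊎ (u ≡ y × v ≡ x)

DistinctPairSums-∘ : {A B : Set} (φ : B → ℕ) (f : A → B) → Injective _≡_ _≡_ f →
  DistinctPairSums φ → DistinctPairSums (φ ∘ f)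
DistinctPairSums-∘ φ f f-inj distinct u v x y u≢v x≢y eq =
  Sum.map (Product.map f-inj f-inj) (Product.map f-inj f-inj)
    (distinct (f u) (f v) (f x) (f y) (u≢v ∘ f-inj) (x≢y ∘ f-inj) eq)

record Dominant (g : ℕ → ℕ) : Set where
  field
    positive   : ∀ i → 1 ≤ g i
    increasing : ∀ i → g i < g (suc i)
    dominant   : ∀ {i j} → j < i → g i + g j ≤ g (suc i)

module DominantSums {g : ℕ → ℕ} (dom : Dominant g) where
  open Dominant dom

  sum-below : ∀ {i j k} l → j < i → i < k → g i + g j < g k + g l
  sum-below {i} {j} {k} l j<i i<k = begin-strict
    g i + g j    ≤⟨ dominant j<i ⟩
    g (suc i)    ≤⟨ monotone-from-steps g (<⇒≤ ∘ increasing) i<k ⟩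
    g k          <⟨ m<m+n (g k) (positive l) ⟩
    g k + g l    ∎
    where open ≤-Reasoning

  ordered-pairs : ∀ {i j k l} → j < i → l < k →
    g i + g j ≡ g k + g l → i ≡ k × j ≡ l
  ordered-pairs {i} {j} {k} {l} j<i l<k eq with <-cmp i k
  ... | tri< i<k _ _ = ⊥-elim (<-irrefl eq (sum-below l j<i i<k))
  ... | tri> _ _ k<i = ⊥-elim (<-irrefl (sym eq) (sum-below j l<k k<i))
  ... | tri≈ _ refl _ =
    refl , injective-from-steps g increasing (+-cancelˡ-≡ (g i) (g j) (g l) eq)

  distinct-pair-sums : DistinctPairSums g
  distinct-pair-sums i j k l i≢j k≢l eq with <-cmp i j | <-cmp k l
  ... | tri≈ _ i≡j _ | _ = ⊥-elim (i≢j i≡j)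
  ... | _ | tri≈ _ k≡l _ = ⊥-elim (k≢l k≡l)
  ... | tri> _ _ j<i | tri> _ _ l<k = inj₁ (ordered-pairs j<i l<k eq)
  ... | tri> _ _ j<i | tri< k<l _ _ =
    inj₂ (ordered-pairs j<i k<l (trans eq (+-comm (g k) (g l))))
  ... | tri< i<j _ _ | tri> _ _ l<k =
    inj₂ (swap (ordered-pairs i<j l<k (trans (+-comm (g j) (g i)) eq)))
  ... | tri< i<j _ _ | tri< k<l _ _ =
    inj₁ (swap (ordered-pairs i<j k<l
      (trans (+-comm (g j) (g i)) (trans eq (+-comm (g k) (g l))))))

fib-step : ∀ m → fib m ≤ fib (suc m)
fib-step zero = z≤n
fib-step (suc zero) = ≤-refl
fib-step (suc (suc m)) = m≤m+n (fib (suc (suc m))) (fib (suc m))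

fib-mono : ∀ {m n} → m ≤ n → fib m ≤ fib n
fib-mono = monotone-from-steps fib fib-step

fib-pos : ∀ m → 1 ≤ fib (suc m)
fib-pos m = fib-mono {1} {suc m} (s≤s z≤n)

fib₂ : ℕ → ℕ
fib₂ i = fib (suc (suc i))

-- The shifted Fibonacci sequence is dominant, since
-- F_{i+2} + F_{j+2} ≤ F_{i+2} + F_{i+1} = F_{i+3} for j < i.
fib₂-dominant : Dominant fib₂
fib₂-dominant = record
  { positive   = λ i → fib-pos (suc i)
  ; increasing = λ i → m<m+n (fib₂ i) (fib-pos i)
  ; dominant   = λ {i} j<i → +-monoʳ-≤ (fib₂ i) (fib-mono (s≤s j<i))
  }

theorem10 : (n : ℕ) → n ≥ 1 →
    Σ (Fin n → ℕ) (λ φ → IsESDLabelingKn n (fib (n + 1)) φ)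
theorem10 n _ = fib₂ ∘ toℕ , record
  { inRange         = λ v → Dominant.positive fib₂-dominant (toℕ v) , label≤ v
  ; injective       = toℕ-injective ∘ injective-from-steps fib₂ increasing
  ; distinctWeights = DistinctPairSums-∘ fib₂ toℕ toℕ-injective distinct-pair-sums
  }
  where
  open Dominant fib₂-dominant using (increasing)
  open DominantSums fib₂-dominant using (distinct-pair-sums)

  label≤ : (v : Fin n) → fib₂ (toℕ v) ≤ fib (n + 1)
  label≤ v = fib-mono (≤-trans (s≤s (toℕ<n v)) (≤-reflexive (+-comm 1 n)))
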